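{- Let $p,q,n$ be positive integers and let $b_1 \leq \ldots \leq b_n$ be positive integers. If there exists a positive integer $k$ such that $k\leq b_1$ and $\gcd(p+q,k) > p$, then Avoider has a winning strategy in the game $mBox(b_1, \ldots, b_n,(p,q))$, both when Avoider is the first player and when he is the second player.
   Context: A $(p,q)$ Avoider-Enforcer game on a finite board $X$ with a family $\mathcal F\subseteq 2^X$ of target sets is played as follows (strict rules): Avoider and Enforcer alternately claim exactly $p$ and exactly $q$ previously unclaimed elements of $X$ per move, respectively; if before a player's move fewer than $p$ (for Avoider) or $q$ (for Enforcer) unclaimed elements remain, that player claims all of them. It is specified which player moves first. The game ends when all elements are claimed; Avoider loses if at the end he has claimed all elements of some target set, otherwise Avoider wins. The misère box game $mBox(b_1,\ldots,b_n,(p,q))$ is the $(p,q)$ Avoider-Enforcer game (strict rules) whose board is the disjoint union of pairwise disjoint sets (boxes) $B_1,\ldots,B_n$ with $|B_i|=b_i$, and whose target sets are exactly $B_1,\ldots,B_n$. -}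

module Defs where

open import Data.Nat using (ℕ; zero; suc; _⊓_)
open import Data.Bool using (Bool)
open import Data.Fin using (Fin)
open import Data.Fin.Properties using (_≟_)
open import Data.Fin.Subset using (Subset; _⊆_; _∪_; ∁; ∣_∣)
open import Data.Vec using (tabulate)
open import Relation.Nullary using (¬_; does)
open import Relation.Binary.PropositionalEquality using (_≡_)

data Turn : Set where
  avoider enforcer : Turn

-- Generic (p,q) Avoider-Enforcer game (strict rules) on the board Fin m with
-- target sets T : I → Subset m.  A position consists of Avoider's claimed set A
-- and Enforcer's claimed set E (disjoint, maintained by the moves).  Since the game is finite, winning strategies are
-- exactly well-founded strategy trees, i.e. this inductive family.
module Game {m : ℕ} {I : Set} (p q : ℕ) (T : I → Subset m) where

  free : Subset m → Subset m → Subset m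
  free A E = ∁ (A ∪ E)

  data AvoiderWins : Turn → Subset m → Subset m → Set where
    finished : ∀ {t A E} → ∣ free A E ∣ ≡ 0 →
               (∀ i → ¬ (T i ⊆ A)) → AvoiderWins t A E
    avoiderMove : ∀ {A E} → ¬ (∣ free A E ∣ ≡ 0) → (S : Subset m) →
                  S ⊆ free A E → ∣ S ∣ ≡ p ⊓ ∣ free A E ∣ →
                  AvoiderWins enforcer (A ∪ S) E → AvoiderWins avoider A E
    enforcerMove : ∀ {A E} → ¬ (∣ free A E ∣ ≡ 0) →
                   ((S : Subset m) → S ⊆ free A E → ∣ S ∣ ≡ q ⊓ ∣ free A E ∣ →
                    AvoiderWins avoider A (E ∪ S)) →
                   AvoiderWins enforcer A E

boxSet : {m n : ℕ} → (Fin m → Fin n) → Fin n → Subset m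
boxSet box i = tabulate (λ x → does (box x ≟ i))

AvoiderWinsMBox : {m n : ℕ} → (Fin m → Fin n) → (p q : ℕ) → Turn → Set
AvoiderWinsMBox {m} box p q t =
  Game.AvoiderWins p q (boxSet box) t Data.Fin.Subset.⊥ Data.Fin.Subset.⊥

-- Then d ∣ p+q, p < d ≤ bᵢ for all i.  A box is *untouched* while Enforcer owns
-- none of its elements; with f free elements its *pool* is f ∸ d and its
-- *deficit* d ∸ f if untouched, else f and 0.  Avoider claims his p elements
-- one by one: from a positive pool if possible, else from an untouched box
-- (raising the total deficit by one).  Invariant: the total pool P and
-- deficit D satisfy P + k ≡ D + u (mod d) with D + u < d, k being the number
-- of elements Avoider has claimed in the current round.  Since d ∣ p+q,
-- Enforcer's move preserves it; it forces every untouched box to keep a free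
-- element, so at the end each box contains an element of Enforcer.
module Submission where

open import Defs
open import Data.Nat using (ℕ; zero; suc; _+_; _*_; _∸_; _⊓_; _≤_; _<_; z≤n; s≤s; s≤s⁻¹; NonZero; >-nonZero)
open import Data.Nat.Properties hiding (_≟_)
open import Data.Nat using () renaming (_≟_ to _≟ℕ_)
open import Data.Nat.GCD using (gcd; gcd[m,n]∣m; gcd[m,n]∣n)
open import Data.Nat.Divisibility using (_∣_; ∣⇒≤)
open import Data.Nat.DivMod using (_%_; _/_; m≡m%n+[m/n]*n; m%n<n)
open import Data.Nat.Tactic.RingSolver using (solve-∀)
open import Algebra.Properties.Semiring.Sum +-*-semiring
  using (sum; sum-cong-≗; ∑-distrib-+; ∑-comm; sum-replicate-zero; *-distribˡ-sum)
open import Data.Bool using (Bool; true; false; _∧_; _∨_; not)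
open import Data.Bool.Properties using (∧-identityʳ; ∨-identityʳ; ∧-zeroʳ; ∧-distribʳ-∨)
open import Data.Fin using (Fin; zero; suc; fromℕ<) renaming (_≤_ to _≤ᶠ_)
open import Data.Fin.Properties using (_≟_; any?)
open import Data.Fin.Subset using (Subset; _∈_; _∉_; _⊆_; _∪_; ⁅_⁆; ∣_∣)
  renaming (⊥ to ∅)
open import Data.Fin.Subset.Properties
  using (x∈⁅x⁆; x∈⁅y⁆⇒x≡y; ∣⁅x⁆∣≡1; ∣⊥∣≡0; ⊆-min; ∉⊥; ∪-assoc; ∪-identityʳ;
         p⊆p∪q; q⊆p∪q; x∈p∪q⁻; x∈∁p⇒x∉p; x∉p⇒x∈∁p; _∈?_)
open import Data.Vec using ([]; _∷_; lookup)
open import Data.Vec.Properties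
  using (lookup-map; lookup-zipWith; lookup-replicate; lookup∘tabulate; []=⇒lookup; lookup⇒[]=)
open import Data.Product using (_×_; _,_; proj₁; proj₂; ∃-syntax)
open import Data.Sum using (inj₁; inj₂; [_,_]′)
open import Data.Empty using (⊥-elim)
open import Relation.Nullary using (¬_; does; yes; no; contradiction; _×-dec_)
open import Relation.Binary.PropositionalEquality

sum-mono : ∀ {n} {f g : Fin n → ℕ} → (∀ i → f i ≤ g i) → sum f ≤ sum g
sum-mono {zero} f≤g = z≤n
sum-mono {suc n} f≤g = +-mono-≤ (f≤g zero) (sum-mono (λ i → f≤g (suc i)))

term≤sum : ∀ {n} (f : Fin n → ℕ) (j : Fin n) → f j ≤ sum f
term≤sum f zero = m≤m+n _ _
term≤sum f (suc j) = ≤-trans (term≤sum (λ i → f (suc i)) j) (m≤n+m _ _)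

sum-zero : ∀ {n} (f : Fin n → ℕ) → (∀ i → f i ≡ 0) → sum f ≡ 0
sum-zero {n} f f≡0 = trans (sum-cong-≗ f≡0) (sum-replicate-zero n)

⟦_⟧ : Bool → ℕ
⟦ true ⟧ = 1
⟦ false ⟧ = 0

count : ∀ {m} → (Fin m → Bool) → ℕ
count g = sum (λ x → ⟦ g x ⟧)

count-cong : ∀ {m} {g h : Fin m → Bool} → (∀ x → g x ≡ h x) → count g ≡ count h
count-cong g≗h = sum-cong-≗ (λ x → cong ⟦_⟧ (g≗h x))

count-∨ : ∀ {m} (g h : Fin m → Bool) → (∀ x → g x ≡ true → h x ≡ false) →
  count (λ x → g x ∨ h x) ≡ count g + count h
count-∨ g h apart = trans (sum-cong-≗ pointwise) (∑-distrib-+ (λ x → ⟦ g x ⟧) (λ x → ⟦ h x ⟧))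
  where
  pointwise : ∀ x → ⟦ g x ∨ h x ⟧ ≡ ⟦ g x ⟧ + ⟦ h x ⟧
  pointwise x with g x in gx
  ... | true rewrite apart x gx = refl
  ... | false = refl

count-at : ∀ {m} (x : Fin m) (h : Fin m → Bool) → count (λ z → does (x ≟ z) ∧ h z) ≡ ⟦ h x ⟧
count-at {suc m} zero h = trans (cong (⟦ h zero ⟧ +_) (sum-zero {m} _ (λ _ → refl))) (+-identityʳ _)
count-at {suc m} (suc x) h = count-at x (λ z → h (suc z))

count-single : ∀ {m} (x : Fin m) → count (λ z → does (x ≟ z)) ≡ 1
count-single {m} x = trans (count-cong {m} (λ z → sym (∧-identityʳ _))) (count-at x (λ _ → true))

count-witness : ∀ {m} (g : Fin m → Bool) → 1 ≤ count g → ∃[ x ] g x ≡ true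
count-witness {suc m} g pos with g zero in g0
... | true = zero , g0
... | false with count-witness (λ x → g (suc x)) pos
... | x , gx = suc x , gx

count-pos : ∀ {m} (g : Fin m → Bool) {x : Fin m} → g x ≡ true → 1 ≤ count g
count-pos g {x} gx = ≤-trans (≤-reflexive (cong ⟦_⟧ (sym gx))) (term≤sum (λ z → ⟦ g z ⟧) x)

count-fibres : ∀ {m n} (c : Fin m → Fin n) (g : Fin m → Bool) →
  count g ≡ sum (λ i → count (λ x → g x ∧ does (c x ≟ i)))
count-fibres {n = n} c g = trans (sum-cong-≗ split) (∑-comm (λ x i → ⟦ g x ∧ does (c x ≟ i) ⟧))
  where
  split : ∀ x → ⟦ g x ⟧ ≡ sum (λ i → ⟦ g x ∧ does (c x ≟ i) ⟧)
  split x with g x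
  ... | true = sym (count-single (c x))
  ... | false = sym (sum-zero {n} _ (λ _ → refl))

sum-plus-point : ∀ {n} (f : Fin n → ℕ) (j : Fin n) → sum (λ i → f i + ⟦ does (j ≟ i) ⟧) ≡ sum f + 1
sum-plus-point f j = trans (∑-distrib-+ f _) (cong (sum f +_) (count-single j))

≟-sound : ∀ {m} {x y : Fin m} → does (x ≟ y) ≡ true → x ≡ y
≟-sound {x = x} {y} eq with x ≟ y
... | yes x≡y = x≡y

≟-refl : ∀ {m} (x : Fin m) → does (x ≟ x) ≡ true
≟-refl x with x ≟ x
... | yes _ = refl
... | no x≢x = ⊥-elim (x≢x refl)

lookup-⁅⁆ : ∀ {m} (x z : Fin m) → lookup ⁅ x ⁆ z ≡ does (x ≟ z)
lookup-⁅⁆ zero zero = refl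
lookup-⁅⁆ zero (suc z) = lookup-replicate z false
lookup-⁅⁆ (suc x) zero = refl
lookup-⁅⁆ (suc x) (suc z) = lookup-⁅⁆ x z

∣∣≡count : ∀ {m} (X : Subset m) → ∣ X ∣ ≡ count (lookup X)
∣∣≡count [] = refl
∣∣≡count (true ∷ X) = cong suc (∣∣≡count X)
∣∣≡count (false ∷ X) = ∣∣≡count X

countWhere : ∀ {m} → Subset m → (Fin m → Bool) → ℕ
countWhere X h = count (λ x → lookup X x ∧ h x)

countWhere-all : ∀ {m} (X : Subset m) → countWhere X (λ _ → true) ≡ ∣ X ∣
countWhere-all X = trans (count-cong (λ x → ∧-identityʳ (lookup X x))) (sym (∣∣≡count X))

countWhere-⁅⁆ : ∀ {m} (x : Fin m) (h : Fin m → Bool) → countWhere ⁅ x ⁆ h ≡ ⟦ h x ⟧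
countWhere-⁅⁆ x h = trans (count-cong (λ z → cong (_∧ h z) (lookup-⁅⁆ x z))) (count-at x h)

countWhere-remove : ∀ {m} {X S : Subset m} (Y : Subset m) → S ⊆ X →
  (∀ x → lookup Y x ≡ lookup X x ∧ not (lookup S x)) →
  ∀ h → countWhere X h ≡ countWhere Y h + countWhere S h
countWhere-remove {X = X} {S} Y S⊆X Y≗X─S h =
  trans (count-cong split) (count-∨ _ _ apart)
  where
  split : ∀ x → lookup X x ∧ h x ≡ (lookup Y x ∧ h x) ∨ (lookup S x ∧ h x)
  split x rewrite Y≗X─S x with lookup S x in Sx
  ... | true rewrite []=⇒lookup (S⊆X (lookup⇒[]= x S Sx)) = refl
  ... | false rewrite ∧-identityʳ (lookup X x) = sym (∨-identityʳ _)
  apart : ∀ x → lookup Y x ∧ h x ≡ true → lookup S x ∧ h x ≡ false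
  apart x Yx with lookup S x in Sx | lookup X x | trans (sym (cong (_∧ h x) (Y≗X─S x))) Yx
  ... | false | _ | _ = refl
  ... | true | true | ()
  ... | true | false | ()

∣∣-remove : ∀ {m} {X S : Subset m} (Y : Subset m) → S ⊆ X →
  (∀ x → lookup Y x ≡ lookup X x ∧ not (lookup S x)) → ∣ Y ∣ + ∣ S ∣ ≡ ∣ X ∣
∣∣-remove {X = X} {S} Y S⊆X Y≗X─S = begin
  ∣ Y ∣ + ∣ S ∣                                               ≡⟨ sym (cong₂ _+_ (countWhere-all Y) (countWhere-all S)) ⟩
  countWhere Y (λ _ → true) + countWhere S (λ _ → true)       ≡⟨ sym (countWhere-remove Y S⊆X Y≗X─S (λ _ → true)) ⟩
  countWhere X (λ _ → true)                                   ≡⟨ countWhere-all X ⟩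
  ∣ X ∣                                                       ∎
  where open ≡-Reasoning

countWhere-∪ : ∀ {m} (X Y : Subset m) → (∀ {x} → x ∈ X → x ∉ Y) →
  ∀ h → countWhere (X ∪ Y) h ≡ countWhere X h + countWhere Y h
countWhere-∪ X Y apart h =
  trans (count-cong split) (count-∨ _ _ apart′)
  where
  split : ∀ x → lookup (X ∪ Y) x ∧ h x ≡ (lookup X x ∧ h x) ∨ (lookup Y x ∧ h x)
  split x = trans (cong (_∧ h x) (lookup-zipWith _∨_ x X Y)) (∧-distribʳ-∨ (h x) (lookup X x) (lookup Y x))
  apart′ : ∀ x → lookup X x ∧ h x ≡ true → lookup Y x ∧ h x ≡ false
  apart′ x Xh with lookup X x in Xx | lookup Y x in Yx | Xh
  ... | true | true | _ = ⊥-elim (apart (lookup⇒[]= x X Xx) (lookup⇒[]= x Y Yx))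
  ... | true | false | _ = refl
  ... | false | _ | ()

∣∪∣-disjoint : ∀ {m} (X Y : Subset m) → (∀ {x} → x ∈ X → x ∉ Y) → ∣ X ∪ Y ∣ ≡ ∣ X ∣ + ∣ Y ∣
∣∪∣-disjoint X Y apart = begin
  ∣ X ∪ Y ∣                                                  ≡⟨ sym (countWhere-all (X ∪ Y)) ⟩
  countWhere (X ∪ Y) (λ _ → true)                            ≡⟨ countWhere-∪ X Y apart (λ _ → true) ⟩
  countWhere X (λ _ → true) + countWhere Y (λ _ → true)      ≡⟨ cong₂ _+_ (countWhere-all X) (countWhere-all Y) ⟩
  ∣ X ∣ + ∣ Y ∣                                              ∎
  where open ≡-Reasoning

∧-true : ∀ {a b} → a ∧ b ≡ true → (a ≡ true) × (b ≡ true)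
∧-true {true} {true} _ = refl , refl

-- max(f,d) computed in two ways.
+-monus-swap : ∀ f d → f + (d ∸ f) ≡ (f ∸ d) + d
+-monus-swap zero zero = refl
+-monus-swap zero (suc d) = refl
+-monus-swap (suc f) zero = refl
+-monus-swap (suc f) (suc d) = trans (cong suc (+-monus-swap f d)) (sym (+-suc (f ∸ d) d))

drop-multiple : ∀ d R P X W → P + R * d ≡ X + d * W → X < d → ∃[ w ] P ≡ X + d * w
drop-multiple d R P X W eq X<d with R ≤? W
... | yes R≤W = W ∸ R , +-cancelʳ-≡ (R * d) P _ (trans eq (regroup (m+[n∸m]≡n R≤W)))
  where
  shift : ∀ X d R w → X + d * (R + w) ≡ X + d * w + R * d
  shift = solve-∀
  regroup : R + (W ∸ R) ≡ W → X + d * W ≡ X + d * (W ∸ R) + R * d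
  regroup e = trans (cong (λ w → X + d * w) (sym e)) (shift X d R (W ∸ R))
... | no R≰W = contradiction chain (<-irrefl refl)
  where
  chain : X + d * W < X + d * W
  chain = begin-strict
      X + d * W     <⟨ +-monoˡ-< (d * W) X<d ⟩
      d + d * W     ≡⟨ sym (*-suc d W) ⟩
      d * suc W     ≤⟨ *-monoʳ-≤ d (≰⇒> R≰W) ⟩
      d * R         ≡⟨ *-comm d R ⟩
      R * d         ≤⟨ m≤n+m (R * d) P ⟩
      P + R * d     ≡⟨ eq ⟩
      X + d * W     ∎
    where open ≤-Reasoning

-- The balance step for Enforcer's move: if P + p ≡ D + u (mod d) and the
-- move changes (P, D) to (P′, D′) with P′ + q + D ≡ P + D′ + d·K, D′ ≤ D,
-- then P′ ≡ D′ + u (mod d), because d divides p + q.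
rebalance : ∀ {d R p q P P′ D D′ u w K} → p + q ≡ R * d →
  P′ + q + D ≡ P + D′ + d * K → P + p ≡ D + u + d * w → D′ ≤ D → D + u < d →
  ∃[ w′ ] P′ ≡ D′ + u + d * w′
rebalance {d} {R} {p} {q} {P} {P′} {D} {D′} {u} {w} {K} p+q≡R*d move balanced D′≤D D+u<d =
  drop-multiple d R P′ (D′ + u) (w + K) (+-cancelʳ-≡ D _ _ shifted) (≤-<-trans (+-monoˡ-≤ u D′≤D) D+u<d)
  where
  open ≡-Reasoning
  step₁ : ∀ P′ p q D → P′ + (p + q) + D ≡ (P′ + q + D) + p
  step₁ = solve-∀
  step₂ : ∀ P D′ d K p → (P + D′ + d * K) + p ≡ (P + p) + (D′ + d * K)
  step₂ = solve-∀
  step₃ : ∀ D u d w D′ K → (D + u + d * w) + (D′ + d * K) ≡ (D′ + u + d * (w + K)) + D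
  step₃ = solve-∀
  shifted : P′ + R * d + D ≡ D′ + u + d * (w + K) + D
  shifted = begin
    P′ + R * d + D                   ≡⟨ cong (λ z → P′ + z + D) (sym p+q≡R*d) ⟩
    P′ + (p + q) + D                 ≡⟨ step₁ P′ p q D ⟩
    (P′ + q + D) + p                 ≡⟨ cong (_+ p) move ⟩
    (P + D′ + d * K) + p             ≡⟨ step₂ P D′ d K p ⟩
    (P + p) + (D′ + d * K)           ≡⟨ cong (_+ (D′ + d * K)) balanced ⟩
    (D + u + d * w) + (D′ + d * K)   ≡⟨ step₃ D u d w D′ K ⟩
    D′ + u + d * (w + K) + D         ∎

residue : ∀ d .{{_ : NonZero d}} X → ∃[ u ] ∃[ w ] ((X ≡ u + d * w) × (u < d))
residue d X = X % d , X / d , trans (m≡m%n+[m/n]*n X d) (cong (X % d +_) (*-comm (X / d) d)) , m%n<n X d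

fewer-left : ∀ {t′ c t k} → t′ + c ≡ t → t ≤ suc k → 1 ≤ c → t′ ≤ k
fewer-left {t′} eq t≤1+k 1≤c =
  s≤s⁻¹ (≤-trans (≤-trans (≤-reflexive (+-comm 1 t′)) (+-monoʳ-≤ t′ 1≤c)) (≤-trans (≤-reflexive eq) t≤1+k))

full-move : ∀ a t t′ → t′ + a ⊓ t ≡ t → ¬ (t′ ≡ 0) → a ⊓ t ≡ a
full-move a t t′ eq t′≢0 with ⊓-sel a t
... | inj₁ a⊓t≡a = a⊓t≡a
... | inj₂ a⊓t≡t = contradiction (+-cancelʳ-≡ (a ⊓ t) t′ 0 (trans eq (sym a⊓t≡t))) t′≢0

module BoxPotential (d : ℕ) where

  -- pool e f and deficit e f for a box with e elements of Enforcer and f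
  -- free elements; the box is untouched when e ≡ 0.
  pool : ℕ → ℕ → ℕ
  pool zero    f = f ∸ d
  pool (suc _) f = f

  deficit : ℕ → ℕ → ℕ
  deficit zero    f = d ∸ f
  deficit (suc _) f = 0

  -- 1 when Enforcer's s elements are his first ones in this box.
  killed : ℕ → ℕ → ℕ
  killed zero    (suc _) = 1
  killed zero    zero    = 0
  killed (suc _) _       = 0

  -- Enforcer claims s of the f = f′ + s free elements: pool and deficit change
  -- by s, up to d when the box stops being untouched.
  enforcer-claims : ∀ e s f′ → pool (e + s) f′ + s + deficit e (f′ + s) ≡
                    pool e (f′ + s) + deficit (e + s) f′ + d * killed e s
  enforcer-claims (suc e) s f′ rewrite *-zeroʳ d = sym (+-identityʳ _)
  enforcer-claims zero zero f′
    rewrite +-identityʳ f′ | *-zeroʳ d | +-identityʳ (f′ ∸ d) = sym (+-identityʳ _)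
  enforcer-claims zero (suc s) f′ = begin
    f + (d ∸ f)          ≡⟨ +-monus-swap f d ⟩
    (f ∸ d) + d          ≡⟨ cong₂ _+_ (sym (+-identityʳ (f ∸ d))) (sym (*-identityʳ d)) ⟩
    (f ∸ d) + 0 + d * 1  ∎
    where
    f : ℕ
    f = f′ + suc s
    open ≡-Reasoning

  deficit-mono : ∀ e s f′ → deficit (e + s) f′ ≤ deficit e (f′ + s)
  deficit-mono (suc e) s f′ = ≤-refl
  deficit-mono zero zero f′ = ≤-reflexive (cong (d ∸_) (sym (+-identityʳ f′)))
  deficit-mono zero (suc s) f′ = z≤n

  untouched-pool : ∀ f → 1 ≤ pool 0 f → d < f
  untouched-pool f pos = m∸n≢0⇒n<m (λ eq → contradiction (subst (1 ≤_) eq pos) λ ())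

  pool-claim : ∀ e f′ f → suc f′ ≡ f → 1 ≤ pool e f →
               (pool e f′ + 1 ≡ pool e f) × (deficit e f′ ≡ deficit e f)
  pool-claim (suc e) f′ .(suc f′) refl _ = +-comm f′ 1 , refl
  pool-claim zero f′ .(suc f′) refl pos =
    trans (+-comm (f′ ∸ d) 1) (sym (+-∸-assoc 1 d≤f′)) ,
    trans (m≤n⇒m∸n≡0 d≤f′) (sym (m≤n⇒m∸n≡0 (m≤n⇒m≤1+n d≤f′)))
    where
    d≤f′ : d ≤ f′
    d≤f′ = s≤s⁻¹ (untouched-pool (suc f′) pos)

  deficit-claim : ∀ f′ f → suc f′ ≡ f → f ≤ d →
                  (pool 0 f′ ≡ pool 0 f) × (deficit 0 f′ ≡ deficit 0 f + 1)
  deficit-claim f′ .(suc f′) refl f≤d =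
    trans (m≤n⇒m∸n≡0 (≤-trans (n≤1+n f′) f≤d)) (sym (m≤n⇒m∸n≡0 f≤d)) ,
    trans (+-∸-assoc 1 f≤d) (+-comm 1 (d ∸ suc f′))

  pool≤free : ∀ e f → pool e f ≤ f
  pool≤free zero f = m∸n≤m f d
  pool≤free (suc e) f = ≤-refl

  empty-pool : ∀ f → pool 0 f ≡ 0 → f ≤ d
  empty-pool f = m∸n≡0⇒m≤n

module BoxGame {m n : ℕ} (box : Fin m → Fin n) (p q d R : ℕ)
  (1≤p : 1 ≤ p) (1≤q : 1 ≤ q) (p<d : p < d) (p+q≡R*d : p + q ≡ R * d) where

  open Game {m} {Fin n} p q (boxSet box)
  open BoxPotential d

  1≤d : 1 ≤ d
  1≤d = ≤-trans 1≤p (<⇒≤ p<d)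

  inBox : Fin m → Fin n → Bool
  inBox x i = does (box x ≟ i)

  inBox-sound : ∀ {x i} → inBox x i ≡ true → box x ≡ i
  inBox-sound {x} {i} = ≟-sound {x = box x} {y = i}

  lookup-free : ∀ A E x → lookup (free A E) x ≡ not (lookup A x ∨ lookup E x)
  lookup-free A E x = trans (lookup-map x not (A ∪ E)) (cong not (lookup-zipWith _∨_ x A E))

  free⇒∉A : ∀ {A E x} → x ∈ free A E → x ∉ A
  free⇒∉A {A} {E} x∈F x∈A = x∈∁p⇒x∉p x∈F (p⊆p∪q E x∈A)

  free⇒∉E : ∀ {A E x} → x ∈ free A E → x ∉ E
  free⇒∉E {A} {E} x∈F x∈E = x∈∁p⇒x∉p x∈F (q⊆p∪q A E x∈E)

  ∉∉⇒free : ∀ {A E x} → x ∉ A → x ∉ E → x ∈ free A E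
  ∉∉⇒free {A} {E} x∉A x∉E = x∉p⇒x∈∁p λ x∈A∪E → [ x∉A , x∉E ]′ (x∈p∪q⁻ A E x∈A∪E)

  free-antitone : ∀ A S E → free (A ∪ S) E ⊆ free A E
  free-antitone A S E x∈F = ∉∉⇒free (λ x∈A → free⇒∉A x∈F (p⊆p∪q S x∈A)) (free⇒∉E x∈F)

  free-after-avoider : ∀ A E S x → lookup (free (A ∪ S) E) x ≡ lookup (free A E) x ∧ not (lookup S x)
  free-after-avoider A E S x
    rewrite lookup-free (A ∪ S) E x | lookup-free A E x | lookup-zipWith _∨_ x A S
    with lookup A x | lookup S x | lookup E x
  ... | true  | _     | _ = refl
  ... | false | true  | e = sym (∧-zeroʳ (not e))
  ... | false | false | e = sym (∧-identityʳ (not e))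

  free-after-enforcer : ∀ A E S x → lookup (free A (E ∪ S)) x ≡ lookup (free A E) x ∧ not (lookup S x)
  free-after-enforcer A E S x
    rewrite lookup-free A (E ∪ S) x | lookup-free A E x | lookup-zipWith _∨_ x E S
    with lookup A x | lookup E x
  ... | true  | _     = refl
  ... | false | true  = refl
  ... | false | false = refl

  freeIn : Subset m → Subset m → Fin n → ℕ
  freeIn A E i = countWhere (free A E) (λ x → inBox x i)

  ownedIn : Subset m → Fin n → ℕ
  ownedIn E i = countWhere E (λ x → inBox x i)

  poolOf deficitOf : Subset m → Subset m → Fin n → ℕ
  poolOf    A E i = pool    (ownedIn E i) (freeIn A E i)
  deficitOf A E i = deficit (ownedIn E i) (freeIn A E i)

  Pool Deficit : Subset m → Subset m → ℕ
  Pool    A E = sum (poolOf A E)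
  Deficit A E = sum (deficitOf A E)

  record Safe (A E : Subset m) : Set where
    field
      disjoint : ∀ {x} → x ∈ A → x ∉ E
      untouched-open : ∀ i → ownedIn E i ≡ 0 → 1 ≤ freeIn A E i
  open Safe

  Balanced : ℕ → Subset m → Subset m → Set
  Balanced k A E = ∃[ u ] ∃[ w ]
    ((Pool A E + k ≡ Deficit A E + u + d * w) × (Deficit A E + u < d))

  balanced-without-deficit : ∀ k A E → Deficit A E ≡ 0 → Balanced k A E
  balanced-without-deficit k A E D≡0 with residue d {{>-nonZero 1≤d}} (Pool A E + k)
  ... | u , w , eq , u<d rewrite D≡0 = u , w , eq , u<d

  module EnforcerMove {A E S : Subset m} (S⊆F : S ⊆ free A E) where

    claimedIn : Fin n → ℕ
    claimedIn i = countWhere S (λ x → inBox x i)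

    freeIn-after : ∀ i → freeIn A (E ∪ S) i + claimedIn i ≡ freeIn A E i
    freeIn-after i = sym (countWhere-remove (free A (E ∪ S)) S⊆F (free-after-enforcer A E S) (λ x → inBox x i))

    ownedIn-after : ∀ i → ownedIn (E ∪ S) i ≡ ownedIn E i + claimedIn i
    ownedIn-after i = countWhere-∪ E S (λ x∈E x∈S → free⇒∉E (S⊆F x∈S) x∈E) (λ x → inBox x i)

    free-count : ∣ free A (E ∪ S) ∣ + ∣ S ∣ ≡ ∣ free A E ∣
    free-count = ∣∣-remove (free A (E ∪ S)) S⊆F (free-after-enforcer A E S)

    per-box : ∀ i → poolOf A (E ∪ S) i + claimedIn i + deficitOf A E i ≡
                    poolOf A E i + deficitOf A (E ∪ S) i + d * killed (ownedIn E i) (claimedIn i)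
    per-box i rewrite ownedIn-after i | sym (freeIn-after i) =
      enforcer-claims (ownedIn E i) (claimedIn i) (freeIn A (E ∪ S) i)

    deficit-decreases : Deficit A (E ∪ S) ≤ Deficit A E
    deficit-decreases = sum-mono bound
      where
      bound : ∀ i → deficitOf A (E ∪ S) i ≤ deficitOf A E i
      bound i rewrite ownedIn-after i | sym (freeIn-after i) =
        deficit-mono (ownedIn E i) (claimedIn i) (freeIn A (E ∪ S) i)

    balance-identity : Pool A (E ∪ S) + ∣ S ∣ + Deficit A E ≡
      Pool A E + Deficit A (E ∪ S) + d * sum (λ i → killed (ownedIn E i) (claimedIn i))
    balance-identity = begin
      Pool A (E ∪ S) + ∣ S ∣ + Deficit A E
        ≡⟨ cong (λ z → Pool A (E ∪ S) + z + Deficit A E) (trans (∣∣≡count S) (count-fibres box (lookup S))) ⟩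
      Pool A (E ∪ S) + sum claimedIn + Deficit A E
        ≡⟨ cong (_+ Deficit A E) (sym (∑-distrib-+ (poolOf A (E ∪ S)) claimedIn)) ⟩
      sum (λ i → poolOf A (E ∪ S) i + claimedIn i) + Deficit A E
        ≡⟨ sym (∑-distrib-+ (λ i → poolOf A (E ∪ S) i + claimedIn i) (deficitOf A E)) ⟩
      sum (λ i → poolOf A (E ∪ S) i + claimedIn i + deficitOf A E i)
        ≡⟨ sum-cong-≗ per-box ⟩
      sum (λ i → poolOf A E i + deficitOf A (E ∪ S) i + d * killed (ownedIn E i) (claimedIn i))
        ≡⟨ ∑-distrib-+ (λ i → poolOf A E i + deficitOf A (E ∪ S) i) (λ i → d * killed (ownedIn E i) (claimedIn i)) ⟩
      sum (λ i → poolOf A E i + deficitOf A (E ∪ S) i) + sum (λ i → d * killed (ownedIn E i) (claimedIn i))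
        ≡⟨ cong₂ _+_ (∑-distrib-+ (poolOf A E) (deficitOf A (E ∪ S))) (sym (*-distribˡ-sum d (λ i → killed (ownedIn E i) (claimedIn i)))) ⟩
      Pool A E + Deficit A (E ∪ S) + d * sum (λ i → killed (ownedIn E i) (claimedIn i))
        ∎
      where open ≡-Reasoning

    -- Boxes untouched after the move were untouched and unclaimed before.
    keeps-safe : Safe A E → Safe A (E ∪ S)
    disjoint (keeps-safe safe) {x} x∈A x∈E∪S =
      [ disjoint safe x∈A , (λ x∈S → free⇒∉A (S⊆F x∈S) x∈A) ]′ (x∈p∪q⁻ E S x∈E∪S)
    untouched-open (keeps-safe safe) i untouched =
      subst (1 ≤_) (trans (sym (freeIn-after i)) (trans (cong (freeIn A (E ∪ S) i +_) none-claimed) (+-identityʳ _)))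
        (untouched-open safe i (m+n≡0⇒m≡0 _ owned≡0))
      where
      owned≡0 : ownedIn E i + claimedIn i ≡ 0
      owned≡0 = trans (sym (ownedIn-after i)) untouched
      none-claimed : claimedIn i ≡ 0
      none-claimed = m+n≡0⇒n≡0 (ownedIn E i) owned≡0

    keeps-balance : ∣ S ∣ ≡ q → Balanced p A E → Balanced 0 A (E ∪ S)
    keeps-balance ∣S∣≡q (u , w , balanced , D+u<d) with rebalance {R = R} p+q≡R*d move balanced deficit-decreases D+u<d
      where
      move : Pool A (E ∪ S) + q + Deficit A E ≡
             Pool A E + Deficit A (E ∪ S) + d * sum (λ i → killed (ownedIn E i) (claimedIn i))
      move = trans (cong (λ s → Pool A (E ∪ S) + s + Deficit A E) (sym ∣S∣≡q)) balance-identity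
    ... | w′ , P′≡ = u , w′ , trans (+-identityʳ _) P′≡ , ≤-<-trans (+-monoˡ-≤ u deficit-decreases) D+u<d

  module AvoiderClaim {A E : Subset m} {x : Fin m} (x∈F : x ∈ free A E) where

    A′ : Subset m
    A′ = A ∪ ⁅ x ⁆

    ⁅x⁆⊆F : ⁅ x ⁆ ⊆ free A E
    ⁅x⁆⊆F z∈⁅x⁆ = subst (_∈ free A E) (sym (x∈⁅y⁆⇒x≡y x z∈⁅x⁆)) x∈F

    freeIn-after : ∀ i → freeIn A′ E i + ⟦ inBox x i ⟧ ≡ freeIn A E i
    freeIn-after i = sym (trans
      (countWhere-remove (free A′ E) ⁅x⁆⊆F (free-after-avoider A E ⁅ x ⁆) (λ z → inBox z i))
      (cong (freeIn A′ E i +_) (countWhere-⁅⁆ x (λ z → inBox z i))))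

    other-box : ∀ i → inBox x i ≡ false → freeIn A′ E i ≡ freeIn A E i
    other-box i outside = trans (sym (+-identityʳ _))
      (subst (λ b → freeIn A′ E i + ⟦ b ⟧ ≡ freeIn A E i) outside (freeIn-after i))

    own-box : suc (freeIn A′ E (box x)) ≡ freeIn A E (box x)
    own-box = trans (+-comm 1 _)
      (subst (λ b → freeIn A′ E (box x) + ⟦ b ⟧ ≡ freeIn A E (box x)) (≟-refl (box x)) (freeIn-after (box x)))

    free-count : ∣ free A′ E ∣ + 1 ≡ ∣ free A E ∣
    free-count = trans (cong (∣ free A′ E ∣ +_) (sym (∣⁅x⁆∣≡1 x)))
                       (∣∣-remove (free A′ E) ⁅x⁆⊆F (free-after-avoider A E ⁅ x ⁆))

    keeps-safe : Safe A E → (ownedIn E (box x) ≡ 0 → 2 ≤ freeIn A E (box x)) → Safe A′ E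
    disjoint (keeps-safe safe _) {z} z∈A′ =
      [ disjoint safe , (λ z∈⁅x⁆ → subst (_∉ E) (sym (x∈⁅y⁆⇒x≡y x z∈⁅x⁆)) (free⇒∉E x∈F)) ]′ (x∈p∪q⁻ A ⁅ x ⁆ z∈A′)
    untouched-open (keeps-safe safe two-left) i untouched with inBox x i in x-in-i
    ... | false = subst (1 ≤_) (sym (other-box i x-in-i)) (untouched-open safe i untouched)
    ... | true with inBox-sound x-in-i
    ... | refl = s≤s⁻¹ (subst (2 ≤_) (sym own-box) (two-left untouched))

    PoolStep DeficitStep : Set
    PoolStep = ∀ i → (poolOf A′ E i + ⟦ inBox x i ⟧ ≡ poolOf A E i) × (deficitOf A′ E i ≡ deficitOf A E i)
    DeficitStep = ∀ i → (poolOf A′ E i ≡ poolOf A E i) × (deficitOf A′ E i ≡ deficitOf A E i + ⟦ inBox x i ⟧)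

    pool-step : 1 ≤ poolOf A E (box x) → PoolStep
    pool-step pos i with inBox x i in x-in-i
    ... | false = trans (+-identityʳ _) (cong (pool (ownedIn E i)) (other-box i x-in-i)) ,
                  cong (deficit (ownedIn E i)) (other-box i x-in-i)
    ... | true with inBox-sound x-in-i
    ... | refl = pool-claim (ownedIn E (box x)) _ _ own-box pos

    deficit-step : ownedIn E (box x) ≡ 0 → freeIn A E (box x) ≤ d → DeficitStep
    deficit-step untouched f≤d i with inBox x i in x-in-i
    ... | false = cong (pool (ownedIn E i)) (other-box i x-in-i) ,
                  trans (cong (deficit (ownedIn E i)) (other-box i x-in-i)) (sym (+-identityʳ _))
    ... | true with inBox-sound x-in-i
    ... | refl rewrite untouched = deficit-claim _ _ own-box f≤d

    pool-sums : PoolStep → (Pool A′ E + 1 ≡ Pool A E) × (Deficit A′ E ≡ Deficit A E)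
    pool-sums step = trans (sym (sum-plus-point (poolOf A′ E) (box x))) (sum-cong-≗ (λ i → proj₁ (step i))) ,
                     sum-cong-≗ (λ i → proj₂ (step i))

    deficit-sums : DeficitStep → (Pool A′ E ≡ Pool A E) × (Deficit A′ E ≡ Deficit A E + 1)
    deficit-sums step = sum-cong-≗ (λ i → proj₁ (step i)) ,
                        trans (sum-cong-≗ (λ i → proj₂ (step i))) (sum-plus-point (deficitOf A E) (box x))

  claim-from-pool : ∀ {k A E x} → x ∈ free A E → 1 ≤ poolOf A E (box x) →
    Safe A E → Balanced k A E → Safe (A ∪ ⁅ x ⁆) E × Balanced (suc k) (A ∪ ⁅ x ⁆) E
  claim-from-pool {k} {A} {E} {x} x∈F pos safe (u , w , balanced , D+u<d) =
    keeps-safe safe two-left , u , w , balanced′ , subst (λ D → D + u < d) (sym D′≡D) D+u<d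
    where
    open AvoiderClaim x∈F
    P′+1≡P : Pool A′ E + 1 ≡ Pool A E
    P′+1≡P = proj₁ (pool-sums (pool-step pos))
    D′≡D : Deficit A′ E ≡ Deficit A E
    D′≡D = proj₂ (pool-sums (pool-step pos))
    two-left : ownedIn E (box x) ≡ 0 → 2 ≤ freeIn A E (box x)
    two-left untouched = ≤-trans (s≤s 1≤d)
      (untouched-pool _ (subst (λ e → 1 ≤ pool e (freeIn A E (box x))) untouched pos))
    open ≡-Reasoning
    balanced′ : Pool A′ E + suc k ≡ Deficit A′ E + u + d * w
    balanced′ = begin
      Pool A′ E + suc k          ≡⟨ sym (+-assoc (Pool A′ E) 1 k) ⟩
      Pool A′ E + 1 + k          ≡⟨ cong (_+ k) P′+1≡P ⟩
      Pool A E + k               ≡⟨ balanced ⟩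
      Deficit A E + u + d * w    ≡⟨ cong (λ D → D + u + d * w) (sym D′≡D) ⟩
      Deficit A′ E + u + d * w   ∎

  pools-empty : ∀ {A E} → ¬ (∃[ x ] (x ∈ free A E × 1 ≤ poolOf A E (box x))) → ∀ i → poolOf A E i ≡ 0
  pools-empty {A} {E} no-pool i with 1 ≤? poolOf A E i
  ... | no ¬pos = n<1⇒n≡0 (≰⇒> ¬pos)
  ... | yes pos with count-witness _ (≤-trans pos (pool≤free (ownedIn E i) (freeIn A E i)))
  ... | x , x-free-in-i with ∧-true x-free-in-i
  ... | x-free , x-in-i = contradiction
        (x , lookup⇒[]= x (free A E) x-free , subst (λ j → 1 ≤ poolOf A E j) (sym (inBox-sound x-in-i)) pos)
        no-pool

  empty-pools-box : ∀ {A E y} → (∀ i → poolOf A E i ≡ 0) → lookup (free A E) y ≡ true →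
    (1 ≤ freeIn A E (box y)) × (ownedIn E (box y) ≡ 0) × (freeIn A E (box y) ≤ d)
  empty-pools-box {A} {E} {y} pools y-free = occupied , untouched , empty-pool _ (pool-at untouched)
    where
    j : Fin n
    j = box y
    occupied : 1 ≤ freeIn A E j
    occupied = count-pos (λ z → lookup (free A E) z ∧ inBox z j) (cong₂ _∧_ y-free (≟-refl j))
    pool-at : ∀ {e} → ownedIn E j ≡ e → pool e (freeIn A E j) ≡ 0
    pool-at owned = subst (λ e → pool e (freeIn A E j) ≡ 0) owned (pools j)
    untouched : ownedIn E j ≡ 0
    untouched with ownedIn E j in owned
    ... | zero = refl
    ... | suc _ = contradiction (subst (1 ≤_) (pool-at owned) occupied) λ ()

  -- An untouched box with a single free element has deficit d ∸ 1 ≥ p; so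
  -- while the total deficit is below p, untouched boxes keep two free elements.
  small-deficit-two-left : ∀ {A E} i → Deficit A E < p → ownedIn E i ≡ 0 → 1 ≤ freeIn A E i →
    2 ≤ freeIn A E i
  small-deficit-two-left {A} {E} i D<p untouched occupied with freeIn A E i in f | occupied
  ... | suc (suc _) | _ = s≤s (s≤s z≤n)
  ... | suc zero | _ = contradiction d≤p (<⇒≱ p<d)
    where
    d≤p : d ≤ p
    d≤p = begin
      d                            ≤⟨ m≤n+m∸n d 1 ⟩
      1 + (d ∸ 1)                  ≡⟨ cong (λ e → 1 + deficit e 1) (sym untouched) ⟩
      1 + deficit (ownedIn E i) 1  ≡⟨ cong (λ f → 1 + deficit (ownedIn E i) f) (sym f) ⟩
      1 + deficitOf A E i          ≤⟨ +-monoʳ-≤ 1 (term≤sum (deficitOf A E) i) ⟩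
      1 + Deficit A E              ≤⟨ D<p ⟩
      p                            ∎
      where open ≤-Reasoning

  -- With all pools empty, Avoider takes any free element y: its box is
  -- untouched, and the balance bounds the total deficit by k < p, so that box
  -- keeps a free element while its deficit, and the total, grows by one.
  claim-from-deficit : ∀ {k A E} → k < p → 1 ≤ ∣ free A E ∣ → Safe A E → Balanced k A E →
    (∀ i → poolOf A E i ≡ 0) →
    ∃[ x ] (x ∈ free A E × Safe (A ∪ ⁅ x ⁆) E × Balanced (suc k) (A ∪ ⁅ x ⁆) E)
  claim-from-deficit {k} {A} {E} k<p nonempty safe (u , w , balanced , D+u<d) pools
    with count-witness (lookup (free A E)) (subst (1 ≤_) (∣∣≡count (free A E)) nonempty)
  ... | y , y-free with empty-pools-box {A} {E} pools y-free
  ... | occupied , untouched , f≤d =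
    y , y∈F , keeps-safe safe (λ _ → two-left) , u , w , balanced′ , D′+u<d
    where
    y∈F : y ∈ free A E
    y∈F = lookup⇒[]= y (free A E) y-free
    open AvoiderClaim y∈F

    D+u≤k : Deficit A E + u ≤ k
    D+u≤k = ≤-trans (m≤m+n _ (d * w))
      (≤-reflexive (sym (trans (cong (_+ k) (sym (sum-zero (poolOf A E) pools))) balanced)))

    two-left : 2 ≤ freeIn A E (box y)
    two-left = small-deficit-two-left {A} {E} (box y) (≤-<-trans (≤-trans (m≤m+n _ u) D+u≤k) k<p) untouched occupied

    P′≡P : Pool A′ E ≡ Pool A E
    P′≡P = proj₁ (deficit-sums (deficit-step untouched f≤d))
    D′≡D+1 : Deficit A′ E ≡ Deficit A E + 1
    D′≡D+1 = proj₂ (deficit-sums (deficit-step untouched f≤d))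

    regroup : ∀ D u e → suc (D + u + e) ≡ D + 1 + u + e
    regroup = solve-∀

    balanced′ : Pool A′ E + suc k ≡ Deficit A′ E + u + d * w
    balanced′ = begin
      Pool A′ E + suc k          ≡⟨ cong (_+ suc k) P′≡P ⟩
      Pool A E + suc k           ≡⟨ +-suc (Pool A E) k ⟩
      suc (Pool A E + k)         ≡⟨ cong suc balanced ⟩
      suc (Deficit A E + u + d * w) ≡⟨ regroup (Deficit A E) u (d * w) ⟩
      Deficit A E + 1 + u + d * w ≡⟨ cong (λ D → D + u + d * w) (sym D′≡D+1) ⟩
      Deficit A′ E + u + d * w   ∎
      where open ≡-Reasoning

    D′+u<d : Deficit A′ E + u < d
    D′+u<d = begin-strict
      Deficit A′ E + u           ≡⟨ cong (_+ u) D′≡D+1 ⟩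
      Deficit A E + 1 + u        ≡⟨ +-assoc (Deficit A E) 1 u ⟩
      Deficit A E + suc u        ≡⟨ +-suc (Deficit A E) u ⟩
      suc (Deficit A E + u)      ≤⟨ s≤s D+u≤k ⟩
      suc k                      ≤⟨ k<p ⟩
      p                          <⟨ p<d ⟩
      d                          ∎
      where open ≤-Reasoning

  avoider-claims-one : ∀ {k A E} → k < p → 1 ≤ ∣ free A E ∣ → Safe A E → Balanced k A E →
    ∃[ x ] (x ∈ free A E × Safe (A ∪ ⁅ x ⁆) E × Balanced (suc k) (A ∪ ⁅ x ⁆) E)
  avoider-claims-one {k} {A} {E} k<p nonempty safe balanced
    with any? (λ x → (x ∈? free A E) ×-dec (1 ≤? poolOf A E (box x)))
  ... | yes (x , x∈F , pos) = x , x∈F , claim-from-pool x∈F pos safe balanced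
  ... | no no-pool = claim-from-deficit k<p nonempty safe balanced (pools-empty no-pool)

  avoider-claims : ∀ j {k A E} → j ≤ ∣ free A E ∣ → k + j ≤ p → Safe A E → Balanced k A E →
    ∃[ S ] (S ⊆ free A E × ∣ S ∣ ≡ j × Safe (A ∪ S) E × Balanced (k + j) (A ∪ S) E)
  avoider-claims zero {k} {A} {E} _ _ safe balanced =
    ∅ , ⊆-min (free A E) , ∣⊥∣≡0 m ,
    subst (λ X → Safe X E) (sym (∪-identityʳ A)) safe ,
    subst₂ (λ k′ X → Balanced k′ X E) (sym (+-identityʳ k)) (sym (∪-identityʳ A)) balanced
  avoider-claims (suc j) {k} {A} {E} j<free k+j<p safe balanced
    with avoider-claims-one k<p (≤-trans (s≤s z≤n) j<free) safe balanced
    where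
    k<p : k < p
    k<p = ≤-trans (s≤s (m≤m+n k j)) (subst (_≤ p) (+-suc k j) k+j<p)
  ... | x , x∈F , safe₁ , balanced₁
    with avoider-claims j {suc k} {A ∪ ⁅ x ⁆} {E} (s≤s⁻¹ (subst (suc j ≤_) (sym left) j<free))
           (subst (_≤ p) (+-suc k j) k+j<p) safe₁ balanced₁
    where
    open AvoiderClaim x∈F
    left : suc ∣ free A′ E ∣ ≡ ∣ free A E ∣
    left = trans (+-comm 1 _) free-count
  ... | S , S⊆F₁ , ∣S∣≡j , safe₂ , balanced₂ =
    ⁅ x ⁆ ∪ S , claimed⊆F , claimed-size ,
    subst (λ X → Safe X E) regroup safe₂ ,
    subst₂ (λ k′ X → Balanced k′ X E) (sym (+-suc k j)) regroup balanced₂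
    where
    open AvoiderClaim x∈F
    regroup : A′ ∪ S ≡ A ∪ (⁅ x ⁆ ∪ S)
    regroup = ∪-assoc A ⁅ x ⁆ S
    claimed⊆F : ⁅ x ⁆ ∪ S ⊆ free A E
    claimed⊆F z∈ = [ ⁅x⁆⊆F , (λ z∈S → free-antitone A ⁅ x ⁆ E (S⊆F₁ z∈S)) ]′ (x∈p∪q⁻ ⁅ x ⁆ S z∈)
    apart : ∀ {z} → z ∈ ⁅ x ⁆ → z ∉ S
    apart {z} z∈⁅x⁆ z∈S = free⇒∉A (S⊆F₁ z∈S) (subst (_∈ A′) (sym (x∈⁅y⁆⇒x≡y x z∈⁅x⁆)) (q⊆p∪q A ⁅ x ⁆ (x∈⁅x⁆ x)))
    claimed-size : ∣ ⁅ x ⁆ ∪ S ∣ ≡ suc j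
    claimed-size = trans (∣∪∣-disjoint ⁅ x ⁆ S apart) (cong₂ _+_ (∣⁅x⁆∣≡1 x) ∣S∣≡j)

  -- The invariant before each move: safety, and balance while the game lasts,
  -- where Avoider has claimed nothing (before his move) or p elements (before
  -- Enforcer's move) of the current round.
  claimedInRound : Turn → ℕ
  claimedInRound avoider  = 0
  claimedInRound enforcer = p

  Invariant : Turn → Subset m → Subset m → Set
  Invariant t A E = Safe A E × (¬ (∣ free A E ∣ ≡ 0) → Balanced (claimedInRound t) A E)

  -- When no element is free, every box contains an element of Enforcer
  -- (untouched boxes of a safe position still have free elements), so no box
  -- lies inside Avoider's set.
  safe-end : ∀ {A E} → ∣ free A E ∣ ≡ 0 → Safe A E → ∀ i → ¬ (boxSet box i ⊆ A)
  safe-end {A} {E} over safe i box⊆A with ownedIn E i in owned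
  ... | zero with count-witness (λ z → lookup (free A E) z ∧ inBox z i) (untouched-open safe i owned)
  ...   | x , x-free-in-i =
          contradiction (subst (1 ≤_) (trans (sym (∣∣≡count (free A E))) over)
                                 (count-pos (lookup (free A E)) (proj₁ (∧-true x-free-in-i)))) λ ()
  safe-end {A} {E} over safe i box⊆A | suc _
    with count-witness (λ z → lookup E z ∧ inBox z i) (subst (1 ≤_) (sym owned) (s≤s z≤n))
  ...   | x , x-owned-in-i with ∧-true x-owned-in-i
  ...   | x-owned , x-in-i =
          disjoint safe (box⊆A (lookup⇒[]= x (boxSet box i) (trans (lookup∘tabulate _ x) x-in-i)))
                        (lookup⇒[]= x E x-owned)

  wins : ∀ t k {A E} → ∣ free A E ∣ ≤ k → Invariant t A E → AvoiderWins t A E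
  wins t k {A} {E} bound (safe , balanced) with ∣ free A E ∣ ≟ℕ 0
  ... | yes over = finished over (safe-end over safe)
  wins t zero bound _ | no going = contradiction (n≤0⇒n≡0 bound) going
  wins avoider (suc k) {A} {E} bound (safe , balanced) | no going
    with avoider-claims (p ⊓ ∣ free A E ∣) (m⊓n≤n p _) (m⊓n≤m p _) safe (balanced going)
  ... | S , S⊆F , ∣S∣≡c , safe′ , balanced-c =
    avoiderMove going S S⊆F ∣S∣≡c (wins enforcer k bound′ (safe′ , balanced′))
    where
    left : ∣ free (A ∪ S) E ∣ + p ⊓ ∣ free A E ∣ ≡ ∣ free A E ∣
    left = trans (cong (∣ free (A ∪ S) E ∣ +_) (sym ∣S∣≡c))
                 (∣∣-remove (free (A ∪ S) E) S⊆F (free-after-avoider A E S))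
    bound′ : ∣ free (A ∪ S) E ∣ ≤ k
    bound′ = fewer-left left bound (⊓-glb 1≤p (n≢0⇒n>0 going))
    balanced′ : ¬ (∣ free (A ∪ S) E ∣ ≡ 0) → Balanced p (A ∪ S) E
    balanced′ still-going = subst (λ c → Balanced c (A ∪ S) E) (full-move p _ _ left still-going) balanced-c
  wins enforcer (suc k) {A} {E} bound (safe , balanced) | no going = enforcerMove going respond
    where
    respond : (S : Subset m) → S ⊆ free A E → ∣ S ∣ ≡ q ⊓ ∣ free A E ∣ → AvoiderWins avoider A (E ∪ S)
    respond S S⊆F ∣S∣≡c = wins avoider k bound′ (keeps-safe safe , balanced′)
      where
      open EnforcerMove S⊆F
      left : ∣ free A (E ∪ S) ∣ + q ⊓ ∣ free A E ∣ ≡ ∣ free A E ∣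
      left = trans (cong (∣ free A (E ∪ S) ∣ +_) (sym ∣S∣≡c)) free-count
      bound′ : ∣ free A (E ∪ S) ∣ ≤ k
      bound′ = fewer-left left bound (⊓-glb 1≤q (n≢0⇒n>0 going))
      balanced′ : ¬ (∣ free A (E ∪ S) ∣ ≡ 0) → Balanced 0 A (E ∪ S)
      balanced′ still-going = keeps-balance (trans ∣S∣≡c (full-move q _ _ left still-going)) (balanced going)

  module Start (d≤box : ∀ i → d ≤ ∣ boxSet box i ∣) where

    freeIn-start : ∀ i → freeIn ∅ ∅ i ≡ ∣ boxSet box i ∣
    freeIn-start i = trans (count-cong all-free) (sym (∣∣≡count (boxSet box i)))
      where
      all-free : ∀ x → lookup (free ∅ ∅) x ∧ inBox x i ≡ lookup (boxSet box i) x
      all-free x rewrite lookup-free ∅ ∅ x | lookup-replicate x false = sym (lookup∘tabulate _ x)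

    ownedIn-start : ∀ i → ownedIn ∅ i ≡ 0
    ownedIn-start i = trans (count-cong (λ x → cong (_∧ inBox x i) (lookup-replicate x false)))
                            (sum-zero {m} _ (λ _ → refl))

    safe-start : Safe ∅ ∅
    disjoint safe-start x∈∅ = contradiction x∈∅ ∉⊥
    untouched-open safe-start i _ = subst (1 ≤_) (sym (freeIn-start i)) (≤-trans 1≤d (d≤box i))

    deficit-start : Deficit ∅ ∅ ≡ 0
    deficit-start = sum-zero (deficitOf ∅ ∅) no-deficit
      where
      no-deficit : ∀ i → deficitOf ∅ ∅ i ≡ 0
      no-deficit i rewrite ownedIn-start i | freeIn-start i = m≤n⇒m∸n≡0 (d≤box i)

    avoider-wins : ∀ t → AvoiderWins t ∅ ∅
    avoider-wins t = wins t _ ≤-refl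
      (safe-start , λ _ → balanced-without-deficit (claimedInRound t) ∅ ∅ deficit-start)

theorem1p2 : (p q n : ℕ) → 0 < p → 0 < q → (n>0 : 0 < n) →
    (b : Fin n → ℕ) → (∀ i → 0 < b i) → (∀ i j → i ≤ᶠ j → b i ≤ b j) →
    (m : ℕ) (box : Fin m → Fin n) → (∀ i → ∣ boxSet box i ∣ ≡ b i) →
    (∃[ k ] (0 < k × k ≤ b (fromℕ< n>0) × p < gcd (p + q) k)) →
    AvoiderWinsMBox box p q avoider × AvoiderWinsMBox box p q enforcer
theorem1p2 p q (suc n) 0<p 0<q _ b _ b-mono m box ∣box∣≡b (k , 0<k , k≤b₀ , p<d) =
  avoider-wins avoider , avoider-wins enforcer
  where
  d : ℕ
  d = gcd (p + q) k
  d∣p+q : d ∣ p + q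
  d∣p+q = gcd[m,n]∣m (p + q) k
  d≤box : ∀ i → d ≤ ∣ boxSet box i ∣
  d≤box i = begin
    d            ≤⟨ ∣⇒≤ {{>-nonZero 0<k}} (gcd[m,n]∣n (p + q) k) ⟩
    k            ≤⟨ k≤b₀ ⟩
    b zero       ≤⟨ b-mono zero i z≤n ⟩
    b i          ≡⟨ sym (∣box∣≡b i) ⟩
    ∣ boxSet box i ∣ ∎
    where open ≤-Reasoning
  open BoxGame box p q d (_∣_.quotient d∣p+q) 0<p 0<q p<d (_∣_.equality d∣p+q)
  open Start d≤box
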